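{- Let $S$ (length $n$) and $L$ (length $m$) be strings over $\Sigma=[1..d]$. For any positions $i\in[1..n]$, $j\in[1..m]$, any vector of counters $\overline{c}=(c_1,\ldots,c_d)\in\prod_{\alpha=1}^{d}[0..n_\alpha]$ and any symbol $\alpha\in\Sigma$: if $S[i]=L[j]=\alpha$ and $c_\alpha=0$, then $\mathrm{DIST}(i,j,\overline{c})=\mathrm{DIST}(i+1,j+1,\overline{c})$.
   Context: For a string $X$, $X[i]$ is its $i$-th symbol and $X[i..j]$ the substring from position $i$ to $j$ (empty if $j<i$). $n_\alpha$ is the number of occurrences of $\alpha$ in $S$. The Swap-Insert Correction distance $\delta(X,Y)$ is the minimum number of operations, each being either an insertion of a symbol at an arbitrary position or a swap of two adjacent symbols, that transform $X$ into $Y$ ($+\infty$ if no such sequence exists). For $i\in[1..n+1]$, $j\in[1..m+1]$ and $\overline{c}\in\prod_{\alpha=1}^{d}[0..n_\alpha]$, $S[i..n]_{\overline{c}}$ denotes the string obtained from $S[i..n]$ by removing, for each $\alpha\in\Sigma$, the first $c_\alpha$ occurrences of $\alpha$ (from left to right), and $\mathrm{DIST}(i,j,\overline{c})=\delta(S[i..n]_{\overline{c}},L[j..m])$; if for some $\alpha$ the string $S[i..n]$ contains fewer than $c_\alpha$ occurrences of $\alpha$, then $\mathrm{DIST}(i,j,\overline{c})=+\infty$. -}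

module Defs where

open import Data.Nat using (ℕ; zero; suc; _+_; _∸_; _≤_)
open import Data.Fin using (Fin)
open import Data.Fin.Properties using (_≟_)
open import Data.List using (List; []; _∷_; _++_; [_]; length; filter; drop)
open import Data.Product using (_×_; _,_)
open import Data.Empty using (⊥)
open import Relation.Nullary using (¬_; Dec; yes; no)
open import Relation.Binary.PropositionalEquality using (_≡_)

Str : ℕ → Set
Str d = List (Fin d)

data ℕ∞ : Set where
  fin : ℕ → ℕ∞
  ∞   : ℕ∞

data Step {d : ℕ} : Str d → Str d → Set where
  insert : (u v : Str d) (a : Fin d) → Step (u ++ v) (u ++ a ∷ v)
  swap   : (u v : Str d) (a b : Fin d) → Step (u ++ a ∷ b ∷ v) (u ++ b ∷ a ∷ v)

data Ops {d : ℕ} : ℕ → Str d → Str d → Set where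
  done : ∀ {X} → Ops zero X X
  step : ∀ {k X Y Z} → Step X Y → Ops k Y Z → Ops (suc k) X Z

HasDelta : {d : ℕ} → Str d → Str d → ℕ∞ → Set
HasDelta X Y (fin k) = Ops k X Y × (∀ k′ → Ops k′ X Y → k ≤ k′)
HasDelta X Y ∞       = ∀ k → ¬ Ops k X Y

count : {d : ℕ} → Fin d → Str d → ℕ
count α X = length (filter (α ≟_) X)

dec : {d : ℕ} → (Fin d → ℕ) → Fin d → (Fin d → ℕ)
dec c a b with a ≟ b
... | yes _ = c b ∸ 1
... | no  _ = c b

-- X_c : remove, for each α, the first c α occurrences of α (left to right).
removeFirst : {d : ℕ} → (Fin d → ℕ) → Str d → Str d
removeFirst c [] = []
removeFirst c (x ∷ xs) with c x
... | zero  = x ∷ removeFirst c xs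
... | suc _ = removeFirst (dec c x) xs

-- Substring X[i..|X|] for 1-based i (empty if i > |X|).
suffix : {d : ℕ} → Str d → ℕ → Str d
suffix X i = drop (i ∸ 1) X

-- X[i] = α, 1-based indexing.
data _[_]≡_ {d : ℕ} : Str d → ℕ → Fin d → Set where
  here  : ∀ {a xs} → (a ∷ xs) [ 1 ]≡ a
  there : ∀ {a b xs i} → xs [ suc i ]≡ b → (a ∷ xs) [ suc (suc i) ]≡ b

HasDIST : {d : ℕ} → Str d → Str d → ℕ → ℕ → (Fin d → ℕ) → ℕ∞ → Set
HasDIST S L i j c v =
  ((∀ α → c α ≤ count α (suffix S i)) →
     HasDelta (removeFirst c (suffix S i)) (suffix L j) v)
  × ((¬ (∀ α → c α ≤ count α (suffix S i))) → v ≡ ∞)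

-- The heart of the proof is δ(αZ, αY) = δ(Z, Y).  Prefixing α to every intermediate
-- string gives ≤.  For ≥, trace the leading α of the target back through k operations.
-- Either an insertion created it, and inserting α at the front of Z instead costs the
-- same; or it is the α at some position p of αZ, the other operations turn αZ minus that
-- α into Y, and at least p of the k operations were swaps moving it leftwards.  For
-- p = 0 this is a sequence from Z; for p > 0 those p swaps pay for moving that α, which
-- lies in Z, to the front of Z.  As c α = 0, the leading α of S[i..n] is never removed
-- and the feasibility of c is unaffected, so DIST(i, j, c) = δ(αZ, αY) with
-- Z = S[i+1..n]_c and Y = L[j+1..m].
module Submission where

open import Defs
open import Data.Nat using (ℕ; zero; suc; _+_; _≤_; z≤n; s≤s)
open import Data.Nat.Properties
  using (≤-refl; ≤-trans; ≤-antisym; ≤-reflexive; m≤n⇒m≤1+n; n≤1+n; +-suc; +-assoc; +-comm;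
         +-monoˡ-≤; m+n∸n≡m; +-commutativeSemigroup; module ≤-Reasoning)
open import Algebra.Properties.CommutativeSemigroup +-commutativeSemigroup using (xy∙z≈xz∙y)
open import Data.Fin using (Fin)
open import Data.Fin.Properties using (_≟_)
open import Data.List using ([]; _∷_; _++_; length; drop)
open import Data.List.Properties using (∷-injective)
open import Data.Product using (Σ-syntax; _×_; _,_)
open import Relation.Nullary using (¬_; yes; no)
open import Relation.Binary.PropositionalEquality using (_≡_; refl; sym; cong; subst; subst₂)

module _ {d : ℕ} where

  infixr 5 _◅◅_
  _◅◅_ : ∀ {j k} {X Y Z : Str d} → Ops j X Y → Ops k Y Z → Ops (j + k) X Z
  done     ◅◅ q = q
  step s p ◅◅ q = step s (p ◅◅ q)

  single : ∀ {X Y : Str d} → Step X Y → Ops 1 X Y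
  single s = step s done

  step-∷ : ∀ b {X Y : Str d} → Step X Y → Step (b ∷ X) (b ∷ Y)
  step-∷ b (insert u v a)  = insert (b ∷ u) v a
  step-∷ b (swap u v a a′) = swap (b ∷ u) v a a′

  ops-∷ : ∀ b {k} {X Y : Str d} → Ops k X Y → Ops k (b ∷ X) (b ∷ Y)
  ops-∷ b done       = done
  ops-∷ b (step s p) = step (step-∷ b s) (ops-∷ b p)

  ops-moveToFront : ∀ (u : Str d) a v → Ops (length u) (u ++ a ∷ v) (a ∷ u ++ v)
  ops-moveToFront []      a v = done
  ops-moveToFront (b ∷ u) a v =
    subst (λ n → Ops n (b ∷ u ++ a ∷ v) (a ∷ b ∷ u ++ v)) (+-comm (length u) 1)
      (ops-∷ b (ops-moveToFront u a v) ◅◅ single (swap [] (u ++ v) b a))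

  -- Where the marked a of w₁ ++ a ∷ w₂ came from.  The bounds charge every leftward
  -- move of the marked symbol to the budget k; this pays for ops-moveToFront in ops-∷⁻.
  data Origin (k : ℕ) (X w₁ : Str d) (a : Fin d) (w₂ : Str d) : Set where
    inserted : ∀ {k′} → Ops k′ X (w₁ ++ w₂) → 1 + k′ ≤ length w₁ + k → Origin k X w₁ a w₂
    moved    : ∀ x₁ x₂ {k′} → X ≡ x₁ ++ a ∷ x₂ → Ops k′ (x₁ ++ x₂) (w₁ ++ w₂) →
               length x₁ + k′ ≤ length w₁ + k → Origin k X w₁ a w₂

  origin-∷ : ∀ b {k X w₁ a w₂} → Origin k X w₁ a w₂ → Origin k (b ∷ X) (b ∷ w₁) a w₂
  origin-∷ b (inserted o le)      = inserted (ops-∷ b o) (m≤n⇒m≤1+n le)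
  origin-∷ b (moved x₁ x₂ e o le) = moved (b ∷ x₁) x₂ (cong (b ∷_) e) (ops-∷ b o) (s≤s le)

  origin-insert : ∀ p q b u a v → p ++ b ∷ q ≡ u ++ a ∷ v → Origin 1 (p ++ q) u a v
  origin-insert []      q b []      a v e with ∷-injective e
  ... | refl , refl = inserted done ≤-refl
  origin-insert []      q b (_ ∷ u) a v e with ∷-injective e
  ... | refl , refl = moved u v refl (single (insert [] (u ++ v) b)) (n≤1+n _)
  origin-insert (_ ∷ p) q b []      a v e with ∷-injective e
  ... | refl , refl = moved [] (p ++ q) refl (single (insert p q b)) ≤-refl
  origin-insert (c ∷ p) q b (_ ∷ u) a v e with ∷-injective e
  ... | refl , e′ = origin-∷ c (origin-insert p q b u a v e′)

  origin-swap : ∀ p q b c u a v → p ++ c ∷ b ∷ q ≡ u ++ a ∷ v → Origin 1 (p ++ b ∷ c ∷ q) u a v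
  origin-swap []      q b c []          a v e with ∷-injective e
  ... | refl , refl = moved (b ∷ []) q refl done ≤-refl
  origin-swap []      q b c (_ ∷ [])    a v e with ∷-injective e
  ... | refl , e′ with ∷-injective e′
  ... | refl , refl = moved [] (c ∷ q) refl done z≤n
  origin-swap []      q b c (_ ∷ _ ∷ u) a v e with ∷-injective e
  ... | refl , e′ with ∷-injective e′
  ... | refl , refl = moved (b ∷ c ∷ u) v refl (single (swap [] (u ++ v) b c)) ≤-refl
  origin-swap (_ ∷ p) q b c []          a v e with ∷-injective e
  ... | refl , refl = moved [] (p ++ b ∷ c ∷ q) refl (single (swap p q b c)) ≤-refl
  origin-swap (x ∷ p) q b c (_ ∷ u)     a v e with ∷-injective e
  ... | refl , e′ = origin-∷ x (origin-swap p q b c u a v e′)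

  origin-step : ∀ {X Y} → Step X Y → ∀ u a v → Y ≡ u ++ a ∷ v → Origin 1 X u a v
  origin-step (insert p q b) = origin-insert p q b
  origin-step (swap p q b c) = origin-swap p q b c

  private
    budget-trans : ∀ x a u j k w l → x + a ≤ u + j → u + k ≤ w + l → x + (a + k) ≤ w + (j + l)
    budget-trans x a u j k w l h₁ h₂ = begin
      x + (a + k)   ≡⟨ sym (+-assoc x a k) ⟩
      (x + a) + k   ≤⟨ +-monoˡ-≤ k h₁ ⟩
      (u + j) + k   ≡⟨ xy∙z≈xz∙y u j k ⟩
      (u + k) + j   ≤⟨ +-monoˡ-≤ j h₂ ⟩
      (w + l) + j   ≡⟨ +-assoc w l j ⟩
      w + (l + j)   ≡⟨ cong (w +_) (+-comm l j) ⟩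
      w + (j + l)   ∎
      where open ≤-Reasoning

  origin-trans : ∀ {j k l X u a v w₁ w₂} → Origin j X u a v → Ops k (u ++ v) (w₁ ++ w₂) →
                 length u + k ≤ length w₁ + l → Origin (j + l) X w₁ a w₂
  origin-trans {j} {k} {l} {u = u} {w₁ = w₁} (inserted {k′} o le) o′ le′ =
    inserted (o ◅◅ o′) (budget-trans 1 k′ (length u) j k (length w₁) l le le′)
  origin-trans {j} {k} {l} {u = u} {w₁ = w₁} (moved x₁ x₂ {k′} e o le) o′ le′ =
    moved x₁ x₂ e (o ◅◅ o′) (budget-trans (length x₁) k′ (length u) j k (length w₁) l le le′)

  ops-origin : ∀ {k X} w₁ a w₂ → Ops k X (w₁ ++ a ∷ w₂) → Origin k X w₁ a w₂
  ops-origin w₁ a w₂ done = moved w₁ w₂ refl done ≤-refl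
  ops-origin {suc k} w₁ a w₂ (step s p) with ops-origin w₁ a w₂ p
  ... | inserted o le = inserted (step s o) (≤-trans (s≤s le) (≤-reflexive (sym (+-suc _ k))))
  ... | moved u v e o le = origin-trans (origin-step s u a v e) o le

  ops-∷⁻ : ∀ {k} a (X Y : Str d) → Ops k (a ∷ X) (a ∷ Y) → Σ[ k′ ∈ ℕ ] Ops k′ X Y × k′ ≤ k
  ops-∷⁻ a X Y o with ops-origin [] a Y o
  ... | inserted o′ le = _ , step (insert [] X a) o′ , le
  ... | moved [] _ e o′ le with ∷-injective e
  ...   | _ , refl = _ , o′ , le
  ops-∷⁻ a X Y o | moved (_ ∷ x₁) x₂ e o′ le with ∷-injective e
  ...   | refl , refl = _ , ops-moveToFront x₁ a x₂ ◅◅ o′ , ≤-trans (n≤1+n _) le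

  HasDelta-∷⁺ : ∀ a (X Y : Str d) v → HasDelta X Y v → HasDelta (a ∷ X) (a ∷ Y) v
  HasDelta-∷⁺ a X Y (fin k) (o , minimal) = ops-∷ a o , λ k′ o′ →
    let (k″ , o″ , k″≤k′) = ops-∷⁻ a X Y o′ in ≤-trans (minimal k″ o″) k″≤k′
  HasDelta-∷⁺ a X Y ∞ none k o = let (k′ , o′ , _) = ops-∷⁻ a X Y o in none k′ o′

  HasDelta-∷⁻ : ∀ a (X Y : Str d) v → HasDelta (a ∷ X) (a ∷ Y) v → HasDelta X Y v
  HasDelta-∷⁻ a X Y (fin k) (o , minimal) with ops-∷⁻ a X Y o
  ... | k′ , o′ , k′≤k =
    subst (λ n → Ops n X Y) (≤-antisym k′≤k (minimal k′ (ops-∷ a o′))) o′ ,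
    λ k″ o″ → minimal k″ (ops-∷ a o″)
  HasDelta-∷⁻ a X Y ∞ none k o = none k (ops-∷ a o)

  Removable : (Fin d → ℕ) → Str d → Set
  Removable c T = ∀ β → c β ≤ count β T

  HasDistOf : (Fin d → ℕ) → Str d → Str d → ℕ∞ → Set
  HasDistOf c T U v = (Removable c T → HasDelta (removeFirst c T) U v) × (¬ Removable c T → v ≡ ∞)

  count-∷ : ∀ β α (T : Str d) → count β T ≤ count β (α ∷ T)
  count-∷ β α T with β ≟ α
  ... | yes _ = n≤1+n _
  ... | no  _ = ≤-refl

  removable-∷⁺ : ∀ c α (T : Str d) → Removable c T → Removable c (α ∷ T)
  removable-∷⁺ c α T h β = ≤-trans (h β) (count-∷ β α T)

  removable-∷⁻ : ∀ c α (T : Str d) → c α ≡ 0 → Removable c (α ∷ T) → Removable c T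
  removable-∷⁻ c α T cα≡0 h β with β ≟ α | h β
  ... | yes refl | _  = subst (_≤ count β T) (sym cα≡0) z≤n
  ... | no  _    | hβ = hβ

  removeFirst-∷ : ∀ c α (T : Str d) → c α ≡ 0 → removeFirst c (α ∷ T) ≡ α ∷ removeFirst c T
  removeFirst-∷ c α T cα≡0 with c α
  ... | zero = refl

  HasDistOf-∷⁻ : ∀ c α (T U : Str d) v → c α ≡ 0 → HasDistOf c (α ∷ T) (α ∷ U) v → HasDistOf c T U v
  HasDistOf-∷⁻ c α T U v cα≡0 (feasible , infeasible) =
    (λ h → HasDelta-∷⁻ α _ U v
             (subst (λ W → HasDelta W (α ∷ U) v) (removeFirst-∷ c α T cα≡0)
               (feasible (removable-∷⁺ c α T h)))) ,
    (λ ¬h → infeasible (λ h → ¬h (removable-∷⁻ c α T cα≡0 h)))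

  HasDistOf-∷⁺ : ∀ c α (T U : Str d) v → c α ≡ 0 → HasDistOf c T U v → HasDistOf c (α ∷ T) (α ∷ U) v
  HasDistOf-∷⁺ c α T U v cα≡0 (feasible , infeasible) =
    (λ h → subst (λ W → HasDelta W (α ∷ U) v) (sym (removeFirst-∷ c α T cα≡0))
             (HasDelta-∷⁺ α _ U v (feasible (removable-∷⁻ c α T cα≡0 h)))) ,
    (λ ¬h → infeasible (λ h → ¬h (removable-∷⁺ c α T h)))

  suffix-at : ∀ {S : Str d} {i α} → S [ i ]≡ α → suffix S i ≡ α ∷ drop i S
  suffix-at here      = refl
  suffix-at (there p) = suffix-at p

  suffix-suc : ∀ (S : Str d) i → suffix S (i + 1) ≡ drop i S
  suffix-suc S i = cong (λ n → drop n S) (m+n∸n≡m i 1)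

lemma1 : {d : ℕ} (S L : Str d) (i j : ℕ) (c : Fin d → ℕ) (α : Fin d) →
         1 ≤ i → i ≤ length S → 1 ≤ j → j ≤ length L →
         (∀ β → c β ≤ count β S) →
         S [ i ]≡ α → L [ j ]≡ α → c α ≡ 0 →
         (v : ℕ∞) →
         (HasDIST S L i j c v → HasDIST S L (i + 1) (j + 1) c v)
         × (HasDIST S L (i + 1) (j + 1) c v → HasDIST S L i j c v)
lemma1 S L i j c α _ _ _ _ _ Sᵢ≡α Lⱼ≡α cα≡0 v =
  (λ h → subst₂ Dist (sym (suffix-suc S i)) (sym (suffix-suc L j))
           (HasDistOf-∷⁻ c α _ _ v cα≡0 (subst₂ Dist (suffix-at Sᵢ≡α) (suffix-at Lⱼ≡α) h))) ,
  (λ h → subst₂ Dist (sym (suffix-at Sᵢ≡α)) (sym (suffix-at Lⱼ≡α))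
           (HasDistOf-∷⁺ c α _ _ v cα≡0 (subst₂ Dist (suffix-suc S i) (suffix-suc L j) h)))
  where
    Dist : Str _ → Str _ → Set
    Dist T U = HasDistOf c T U v
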